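{- Let $n\ge 2$ and let $a_1,\dots,a_n$ be positive integers with $\gcd(a_1,\dots,a_n)=1$. Let $d=\gcd(a_1,a_2,\dots,a_{n-1},a_n-1)$. Then the Frobenius number $F(a_1,\dots,a_n)$ is divisible by $d$.
   Context: For positive integers $a_1,\dots,a_n$ with $\gcd(a_1,\dots,a_n)=1$, let $S=S(a_1,\dots,a_n)=\{x_1a_1+\dots+x_na_n : x_i\in\mathbb{Z}_{\ge 0}\}$ be the numerical semigroup they generate. The Frobenius number is $F(a_1,\dots,a_n)=\min\{s\in S : \text{every integer } k\ge s \text{ lies in } S\}$ (so $F-1$ is the largest integer not in $S$, and $F=0$ if $S=\mathbb{Z}_{\ge 0}$). Here $\gcd(\dots,0)$ is understood in the usual way if $a_n=1$. -}

module Defs where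

open import Data.Nat using (ℕ; zero; suc; _+_; _*_; _≤_; _∸_)
open import Data.Nat.GCD using (gcd)
open import Data.Fin using (Fin; zero; suc)
open import Data.Product using (Σ; ∃; _×_)
open import Relation.Binary.PropositionalEquality using (_≡_)

sumFin : (n : ℕ) → (Fin n → ℕ) → ℕ
sumFin zero    f = 0
sumFin (suc n) f = f zero + sumFin n (λ i → f (suc i))

gcdFin : (n : ℕ) → (Fin n → ℕ) → ℕ
gcdFin zero    f = 0
gcdFin (suc n) f = gcd (f zero) (gcdFin n (λ i → f (suc i)))

InSemigroup : (n : ℕ) → (Fin n → ℕ) → ℕ → Set
InSemigroup n a s = ∃ λ (x : Fin n → ℕ) → s ≡ sumFin n (λ i → x i * a i)

-- F is the Frobenius number of a, in the paper's convention:
-- the least s ∈ S such that every k ≥ s lies in S.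
IsFrobenius : (n : ℕ) → (Fin n → ℕ) → ℕ → Set
IsFrobenius n a F =
  InSemigroup n a F ×
  ((k : ℕ) → F ≤ k → InSemigroup n a k) ×
  ((s : ℕ) → InSemigroup n a s → ((k : ℕ) → s ≤ k → InSemigroup n a k) → F ≤ s)

-- the family (a_1, …, a_{n-1}, a_n - 1) for a family indexed by Fin (suc m)
-- (the last index is fromℕ m); a_n ≥ 1 in the theorem, so ∸ is exact subtraction
decLast : (m : ℕ) → (Fin (suc m) → ℕ) → Fin (suc m) → ℕ
decLast zero    a zero    = a zero ∸ 1
decLast (suc m) a zero    = a zero
decLast (suc m) a (suc i) = decLast m (λ j → a (suc j)) i

module Submission where

-- Write b = (a₁, …, a_{n-1}, aₙ - 1) and d = gcd(b).  Two facts drive the proof.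
--
--   (1) Dichotomy for the last generator: every s ∈ S(a) is either divisible
--       by d, or satisfies s - aₙ ∈ S(a).  Write s = Σ xᵢ aᵢ.  If xₙ = 0 then
--       s = Σ xᵢ bᵢ, a combination of the bᵢ, hence d ∣ s; if xₙ ≥ 1 one copy
--       of aₙ can be removed from the representation.
--   (2) Just below the Frobenius number: if F = F' + 1 is the Frobenius number
--       then F' ∉ S, since otherwise F' would be a smaller threshold.
--
-- For F = F' + 1, apply (1) to s = F' + aₙ = F + (aₙ - 1) ≥ F, which lies in S.
-- By (2) the second alternative is impossible, so d ∣ F + (aₙ - 1), and since
-- d ∣ bₙ = aₙ - 1 we get d ∣ F.

open import Defs
open import Data.Nat using (ℕ; zero; suc; _+_; _*_; _∸_; _≤_; _<_; s≤s)
open import Data.Nat.Properties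
  using (+-assoc; +-comm; +-suc; +-cancelʳ-≡; m≤m+n; <-irrefl; m≤n⇒m<n∨m≡n)
open import Data.Nat.Divisibility
  using (_∣_; ∣-trans; _∣0; ∣n⇒∣m*n; ∣m∣n⇒∣m+n; ∣m+n∣m⇒∣n)
open import Data.Nat.GCD using (gcd[m,n]∣m; gcd[m,n]∣n)
open import Data.Fin using (Fin; zero; suc; fromℕ)
open import Data.Product using (∃; _×_; _,_)
open import Data.Sum using (_⊎_; inj₁; inj₂; [_,_]′)
open import Data.Empty using (⊥-elim)
open import Relation.Binary.PropositionalEquality
  using (_≡_; refl; sym; trans; cong; subst)
open import Relation.Nullary using (¬_)

gcdFin-∣ : (n : ℕ) (f : Fin n → ℕ) (i : Fin n) → gcdFin n f ∣ f i
gcdFin-∣ (suc n) f zero    = gcd[m,n]∣m (f zero) _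
gcdFin-∣ (suc n) f (suc i) =
  ∣-trans (gcd[m,n]∣n (f zero) _) (gcdFin-∣ n (λ j → f (suc j)) i)

∣-combination : (n d : ℕ) (f x : Fin n → ℕ) → ((i : Fin n) → d ∣ f i) →
  d ∣ sumFin n (λ i → x i * f i)
∣-combination zero    d f x d∣f = d ∣0
∣-combination (suc n) d f x d∣f =
  ∣m∣n⇒∣m+n (∣n⇒∣m*n (x zero) (d∣f zero))
            (∣-combination n d (λ j → f (suc j)) (λ j → x (suc j)) (λ j → d∣f (suc j)))

decLast-last : (m : ℕ) (a : Fin (suc m) → ℕ) → decLast m a (fromℕ m) ≡ a (fromℕ m) ∸ 1
decLast-last zero    a = refl
decLast-last (suc m) a = decLast-last m (λ j → a (suc j))

-- a and decLast m a differ only in the last entry, so a combination that does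
-- not use the last generator has the same value with respect to both.
combination-decLast : (m : ℕ) (a x : Fin (suc m) → ℕ) → x (fromℕ m) ≡ 0 →
  sumFin (suc m) (λ i → x i * a i) ≡ sumFin (suc m) (λ i → x i * decLast m a i)
combination-decLast zero    a x xₙ≡0 rewrite xₙ≡0 = refl
combination-decLast (suc m) a x xₙ≡0 =
  cong (x zero * a zero +_)
       (combination-decLast m (λ j → a (suc j)) (λ j → x (suc j)) xₙ≡0)

remove-generator : (n : ℕ) (a x : Fin n → ℕ) (j : Fin n) (k : ℕ) → x j ≡ suc k →
  ∃ λ (y : Fin n → ℕ) →
    sumFin n (λ i → x i * a i) ≡ sumFin n (λ i → y i * a i) + a j
remove-generator (suc n) a x zero k xⱼ≡1+k = y , shift
  where
  y : Fin (suc n) → ℕ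
  y zero    = k
  y (suc i) = x (suc i)
  rest : ℕ
  rest = sumFin n (λ i → x (suc i) * a (suc i))
  shift : x zero * a zero + rest ≡ k * a zero + rest + a zero
  shift rewrite xⱼ≡1+k =
    trans (+-assoc (a zero) (k * a zero) rest) (+-comm (a zero) (k * a zero + rest))
remove-generator (suc n) a x (suc j) k xⱼ≡1+k
  with remove-generator n (λ i → a (suc i)) (λ i → x (suc i)) j k xⱼ≡1+k
... | y , rest≡ = y′ , trans (cong (x zero * a zero +_) rest≡)
                             (sym (+-assoc (x zero * a zero) _ (a (suc j))))
  where
  y′ : Fin (suc n) → ℕ
  y′ zero    = x zero
  y′ (suc i) = y i

last-generator-dichotomy : (m : ℕ) (a : Fin (suc m) → ℕ) (s : ℕ) →
  InSemigroup (suc m) a s →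
  gcdFin (suc m) (decLast m a) ∣ s ⊎
  ∃ λ s′ → InSemigroup (suc m) a s′ × s ≡ s′ + a (fromℕ m)
last-generator-dichotomy m a s (x , s≡) with x (fromℕ m) in xₙ≡
... | zero  = inj₁ (subst (_ ∣_) (sym (trans s≡ (combination-decLast m a x xₙ≡)))
                     (∣-combination (suc m) _ (decLast m a) x
                        (gcdFin-∣ (suc m) (decLast m a))))
... | suc k with remove-generator (suc m) a x (fromℕ m) k xₙ≡
...   | y , x≡y+aₙ = inj₂ (_ , (y , refl) , trans s≡ x≡y+aₙ)

-- Fact (2): the predecessor of a positive Frobenius number is not in S, since
-- otherwise it would itself be an element of S above which everything lies in S.
Frobenius-pred∉S : (n : ℕ) (a : Fin n → ℕ) (F′ : ℕ) →
  IsFrobenius n a (suc F′) → ¬ InSemigroup n a F′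
Frobenius-pred∉S n a F′ (_ , above-F , minimal) F′∈S =
  <-irrefl refl (minimal F′ F′∈S above-F′)
  where
  above-F′ : (k : ℕ) → F′ ≤ k → InSemigroup n a k
  above-F′ k F′≤k with m≤n⇒m<n∨m≡n F′≤k
  ... | inj₁ F′<k = above-F k F′<k
  ... | inj₂ refl = F′∈S

theorem1 : (m : ℕ) → 1 ≤ m → (a : Fin (suc m) → ℕ) →
    ((i : Fin (suc m)) → 0 < a i) →
    gcdFin (suc m) a ≡ 1 →
    (F : ℕ) → IsFrobenius (suc m) a F →
    gcdFin (suc m) (decLast m a) ∣ F
theorem1 m _ a _   _ zero     _ = _ ∣0
theorem1 m _ a pos _ (suc F′) isFrob@(_ , above-F , _)
  with a (fromℕ m) in aₙ≡ | pos (fromℕ m)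
... | suc c | _ =
  [ divisible , impossible ]′ (last-generator-dichotomy m a (F′ + suc c) s∈S)
  where
  d : ℕ
  d = gcdFin (suc m) (decLast m a)
  s∈S : InSemigroup (suc m) a (F′ + suc c)
  s∈S = above-F (F′ + suc c) (subst (suc F′ ≤_) (sym (+-suc F′ c)) (s≤s (m≤m+n F′ c)))
  -- d divides bₙ = aₙ - 1 = c, and s = c + F
  divisible : d ∣ F′ + suc c → d ∣ suc F′
  divisible d∣s = ∣m+n∣m⇒∣n (subst (d ∣_) (trans (+-comm F′ (suc c)) (sym (+-suc c F′))) d∣s)
    (subst (d ∣_) (trans (decLast-last m a) (cong (_∸ 1) aₙ≡))
           (gcdFin-∣ (suc m) (decLast m a) (fromℕ m)))
  impossible : (∃ λ s′ → InSemigroup (suc m) a s′ × F′ + suc c ≡ s′ + a (fromℕ m)) →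
    d ∣ suc F′
  impossible (s′ , s′∈S , s≡s′+aₙ) =
    ⊥-elim (Frobenius-pred∉S (suc m) a F′ isFrob
              (subst (InSemigroup (suc m) a) (sym F′≡s′) s′∈S))
    where
    F′≡s′ : F′ ≡ s′
    F′≡s′ = +-cancelʳ-≡ (suc c) F′ s′ (subst (λ t → F′ + suc c ≡ s′ + t) aₙ≡ s≡s′+aₙ)
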